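{- Every strictly positive formula $A$ in the language of $\mathrm{RC}^\nabla$ is $\mathrm{RC}^\nabla$-provably equivalent to an ordered formula.
   Context: Strictly positive formulas are built from propositional variables and $\top$ by $\land$ and unary modalities $\Diamond_n,\nabla_n$ ($n<\omega$). A formula is ordered if no modality with a smaller index (whether $\Diamond_i$ or $\nabla_i$) occurs within the scope of a modality with a larger index. $\mathrm{RC}^\nabla$ is the smallest set of sequents $A\vdash B$ containing the following axioms and closed under the following rules and under substitution: (1) $A\vdash A$; $A\vdash\top$; $A\land B\vdash A$; $A\land B\vdash B$; from $A\vdash B$, $B\vdash C$ infer $A\vdash C$; from $A\vdash B$, $A\vdash C$ infer $A\vdash B\land C$; from $A\vdash B$ infer $aA\vdash aB$ for each modality $a$; (2) $aaA\vdash aA$ for each modality $a$; (3) for $m<n$: $\Diamond_nA\vdash\Diamond_mA$, $\Diamond_nA\land\Diamond_mB\vdash\Diamond_n(A\land\Diamond_mB)$, and the same two with $\nabla$ in place of $\Diamond$; (4) $A\vdash\nabla_nA$, $\Diamond_nA\vdash\nabla_nA$; (5) for $m\le n$: $\Diamond_m\nabla_nA\vdash\Diamond_mA$, $\nabla_n\Diamond_mA\vdash\Diamond_mA$. Equivalence means provability of both $A\vdash B$ and $B\vdash A$. -}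

module Defs where

open import Data.Nat using (ℕ; _<_; _≤_)
open import Data.Product using (_×_)
open import Data.Unit using (⊤)

data Kind : Set where
  dia nab : Kind

data Fm : Set where
  var  : ℕ → Fm
  top  : Fm
  _∧_  : Fm → Fm → Fm
  mod  : Kind → ℕ → Fm → Fm

infixr 6 _∧_

◇ : ℕ → Fm → Fm
◇ n A = mod dia n A

∇ : ℕ → Fm → Fm
∇ n A = mod nab n A

sub : (ℕ → Fm) → Fm → Fm
sub σ (var p)     = σ p
sub σ top         = top
sub σ (A ∧ B)     = sub σ A ∧ sub σ B
sub σ (mod k n A) = mod k n (sub σ A)

AllIdx≥ : ℕ → Fm → Set
AllIdx≥ n (var p)     = ⊤
AllIdx≥ n top         = ⊤
AllIdx≥ n (A ∧ B)     = AllIdx≥ n A × AllIdx≥ n B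
AllIdx≥ n (mod k m A) = n ≤ m × AllIdx≥ n A

Ordered : Fm → Set
Ordered (var p)     = ⊤
Ordered top         = ⊤
Ordered (A ∧ B)     = Ordered A × Ordered B
Ordered (mod k n A) = AllIdx≥ n A × Ordered A

infix 4 _⊢_
data _⊢_ : Fm → Fm → Set where
  ax    : ∀ {A} → A ⊢ A
  topR  : ∀ {A} → A ⊢ top
  ∧E₁   : ∀ {A B} → A ∧ B ⊢ A
  ∧E₂   : ∀ {A B} → A ∧ B ⊢ B
  cut   : ∀ {A B C} → A ⊢ B → B ⊢ C → A ⊢ C
  ∧I    : ∀ {A B C} → A ⊢ B → A ⊢ C → A ⊢ B ∧ C
  monR  : ∀ {A B} k n → A ⊢ B → mod k n A ⊢ mod k n B
  trans : ∀ {A} k n → mod k n (mod k n A) ⊢ mod k n A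
  mono  : ∀ {A} k {m n} → m < n → mod k n A ⊢ mod k m A
  mix   : ∀ {A B} k {m n} → m < n →
          mod k n A ∧ mod k m B ⊢ mod k n (A ∧ mod k m B)
  refl∇ : ∀ {A} n → A ⊢ ∇ n A
  ◇∇    : ∀ {A} n → ◇ n A ⊢ ∇ n A
  ◇∇◇   : ∀ {A m n} → m ≤ n → ◇ m (∇ n A) ⊢ ◇ m A
  ∇◇◇   : ∀ {A m n} → m ≤ n → ∇ n (◇ m A) ⊢ ◇ m A
  subst : ∀ {A B} (σ : ℕ → Fm) → A ⊢ B → sub σ A ⊢ sub σ B

_≣_ : Fm → Fm → Set
A ≣ B = (A ⊢ B) × (B ⊢ A)

-- The only non-trivial case is a modality over an
-- already ordered formula A. Up to equivalence, A is a conjunction R ∧ L in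
-- which every index of R is ≥ n and L is a conjunction of modalities of index
-- < n. Such a low modality can be pulled out of the scope of an n-modality,
-- ◇ₙ/∇ₙ (X ∧ aₘ B) ≣ ◇ₙ/∇ₙ X ∧ bₘ B with b = ◇ unless both modalities are ∇,
-- by axioms (3)–(5); pulling out all of L leaves mod k n R ∧ L′, which is
-- ordered.
module Submission where

open import Defs
open import Data.Nat using (ℕ; _<_; _≤_)
open import Data.Nat.Properties using (_<?_; ≮⇒≥; ≤-refl; ≤-trans; <⇒≤)
open import Data.Product using (Σ; Σ-syntax; _×_; _,_; proj₁)
open import Data.Unit using (tt)
open import Relation.Binary.Bundles using (Setoid)
open import Relation.Nullary using (yes; no)

≣-refl : ∀ {A} → A ≣ A
≣-refl = ax , ax

≣-sym : ∀ {A B} → A ≣ B → B ≣ A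
≣-sym (p , q) = q , p

≣-trans : ∀ {A B C} → A ≣ B → B ≣ C → A ≣ C
≣-trans (p , q) (r , s) = cut p r , cut s q

≣-setoid : Setoid _ _
≣-setoid = record
  { Carrier       = Fm
  ; _≈_           = _≣_
  ; isEquivalence = record { refl = ≣-refl ; sym = ≣-sym ; trans = ≣-trans }
  }

open import Relation.Binary.Reasoning.Setoid ≣-setoid

∧-mono : ∀ {A A′ B B′} → A ⊢ A′ → B ⊢ B′ → A ∧ B ⊢ A′ ∧ B′
∧-mono p q = ∧I (cut ∧E₁ p) (cut ∧E₂ q)

∧-cong : ∀ {A A′ B B′} → A ≣ A′ → B ≣ B′ → (A ∧ B) ≣ (A′ ∧ B′)
∧-cong (p , q) (r , s) = ∧-mono p r , ∧-mono q s

mod-cong : ∀ {A B} k n → A ≣ B → mod k n A ≣ mod k n B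
mod-cong k n (p , q) = monR k n p , monR k n q

∧-identityˡ : ∀ {A} → (top ∧ A) ≣ A
∧-identityˡ = ∧E₂ , ∧I topR ax

∧-identityʳ : ∀ {A} → (A ∧ top) ≣ A
∧-identityʳ = ∧E₁ , ∧I ax topR

∧-assoc : ∀ {A B C} → ((A ∧ B) ∧ C) ≣ (A ∧ (B ∧ C))
∧-assoc = ∧I (cut ∧E₁ ∧E₁) (∧I (cut ∧E₁ ∧E₂) ∧E₂)
        , ∧I (∧I ∧E₁ (cut ∧E₂ ∧E₁)) (cut ∧E₂ ∧E₂)

∧-interchange : ∀ {A B C D} → ((A ∧ B) ∧ (C ∧ D)) ≣ ((A ∧ C) ∧ (B ∧ D))
∧-interchange = interchange , interchange
  where
  interchange : ∀ {A B C D} → (A ∧ B) ∧ (C ∧ D) ⊢ (A ∧ C) ∧ (B ∧ D)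
  interchange = ∧I (∧-mono ∧E₁ ∧E₁) (∧-mono ∧E₂ ∧E₂)

_⊔_ : Kind → Kind → Kind
dia ⊔ j = dia
nab ⊔ j = j

mod-mod-lower : ∀ {B} k j {m n} → m < n → mod k n (mod j m B) ⊢ mod (k ⊔ j) m B
mod-mod-lower dia dia m<n = cut (mono dia m<n) (trans dia _)
mod-mod-lower dia nab m<n = cut (mono dia m<n) (◇∇◇ ≤-refl)
mod-mod-lower nab dia m<n = ∇◇◇ (<⇒≤ m<n)
mod-mod-lower nab nab m<n = cut (mono nab m<n) (trans nab _)

mod-∧-lower⊢ : ∀ {X B} k j {m n} → m < n →
               mod k n X ∧ mod (k ⊔ j) m B ⊢ mod k n (X ∧ mod j m B)
mod-∧-lower⊢ dia dia m<n = mix dia m<n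
mod-∧-lower⊢ dia nab m<n = cut (mix dia m<n) (monR dia _ (∧-mono ax (◇∇ _)))
mod-∧-lower⊢ nab dia m<n =
  cut (∧-mono ax (refl∇ _)) (cut (mix nab m<n) (monR nab _ (∧-mono ax (∇◇◇ ≤-refl))))
mod-∧-lower⊢ nab nab m<n = mix nab m<n

mod-∧-lower : ∀ {X B} k j {m n} → m < n →
              mod k n (X ∧ mod j m B) ≣ (mod k n X ∧ mod (k ⊔ j) m B)
mod-∧-lower k j m<n =
  ∧I (monR k _ ∧E₁) (cut (monR k _ ∧E₂) (mod-mod-lower k j m<n)) , mod-∧-lower⊢ k j m<n

data Low (n : ℕ) : Fm → Set where
  top : Low n top
  _∧_ : ∀ {A B} → Low n A → Low n B → Low n (A ∧ B)
  mod : ∀ {k m B} → m < n → Ordered (mod k m B) → Low n (mod k m B)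

mod-∧-Low : ∀ k {n L} → Low n L →
            Σ[ L′ ∈ Fm ] Ordered L′ × (∀ X → mod k n (X ∧ L) ≣ (mod k n X ∧ L′))
mod-∧-Low k top = top , tt , λ X → ≣-trans (mod-cong k _ ∧-identityʳ) (≣-sym ∧-identityʳ)
mod-∧-Low k (mod {j} m<n o) = _ , o , λ X → mod-∧-lower k j m<n
mod-∧-Low k {n} (_∧_ {L₁} {L₂} low₁ low₂)
  with mod-∧-Low k low₁ | mod-∧-Low k low₂
... | L₁′ , o₁ , pull₁ | L₂′ , o₂ , pull₂ = L₁′ ∧ L₂′ , (o₁ , o₂) , pull
  where
  pull : ∀ X → mod k n (X ∧ (L₁ ∧ L₂)) ≣ (mod k n X ∧ (L₁′ ∧ L₂′))
  pull X = begin
    mod k n (X ∧ (L₁ ∧ L₂))     ≈⟨ mod-cong k n (≣-sym ∧-assoc) ⟩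
    mod k n ((X ∧ L₁) ∧ L₂)     ≈⟨ pull₂ (X ∧ L₁) ⟩
    mod k n (X ∧ L₁) ∧ L₂′      ≈⟨ ∧-cong (pull₁ X) ≣-refl ⟩
    (mod k n X ∧ L₁′) ∧ L₂′     ≈⟨ ∧-assoc ⟩
    mod k n X ∧ (L₁′ ∧ L₂′)     ∎

AllIdx≥-weaken : ∀ {m n} → m ≤ n → ∀ A → AllIdx≥ n A → AllIdx≥ m A
AllIdx≥-weaken m≤n (var p)     _         = tt
AllIdx≥-weaken m≤n top         _         = tt
AllIdx≥-weaken m≤n (A ∧ B)     (a , b)   = AllIdx≥-weaken m≤n A a , AllIdx≥-weaken m≤n B b
AllIdx≥-weaken m≤n (mod k i A) (n≤i , a) = ≤-trans m≤n n≤i , AllIdx≥-weaken m≤n A a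

split-Low : ∀ n A → Ordered A →
            Σ[ R ∈ Fm ] Σ[ L ∈ Fm ] Ordered R × AllIdx≥ n R × Low n L × A ≣ (R ∧ L)
split-Low n (var p) _ = var p , top , tt , tt , top , ≣-sym ∧-identityʳ
split-Low n top     _ = top , top , tt , tt , top , ≣-sym ∧-identityʳ
split-Low n (A ∧ B) (oA , oB) with split-Low n A oA | split-Low n B oB
... | R₁ , L₁ , oR₁ , hR₁ , low₁ , eA | R₂ , L₂ , oR₂ , hR₂ , low₂ , eB =
  R₁ ∧ R₂ , L₁ ∧ L₂ , (oR₁ , oR₂) , (hR₁ , hR₂) , low₁ ∧ low₂ ,
  ≣-trans (∧-cong eA eB) ∧-interchange
split-Low n (mod k m B) o with m <? n
... | yes m<n = top , mod k m B , tt , tt , mod m<n o , ≣-sym ∧-identityˡ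
... | no m≮n  = mod k m B , top , o , (n≤m , AllIdx≥-weaken n≤m B (proj₁ o)) , top ,
                ≣-sym ∧-identityʳ
  where n≤m = ≮⇒≥ m≮n

lemma3 : (A : Fm) → Σ Fm (λ B → Ordered B × (A ≣ B))
lemma3 (var p) = var p , tt , ≣-refl
lemma3 top     = top , tt , ≣-refl
lemma3 (A ∧ B) with lemma3 A | lemma3 B
... | A′ , oA , eA | B′ , oB , eB = A′ ∧ B′ , (oA , oB) , ∧-cong eA eB
lemma3 (mod k n A) with lemma3 A
... | A′ , oA′ , eA with split-Low n A′ oA′
... | R , L , oR , hR , low , eA′ with mod-∧-Low k low
... | L′ , oL′ , pull = mod k n R ∧ L′ , ((hR , oR) , oL′) , (begin
  mod k n A         ≈⟨ mod-cong k n (≣-trans eA eA′) ⟩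
  mod k n (R ∧ L)   ≈⟨ pull R ⟩
  mod k n R ∧ L′    ∎)
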